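{- Let $p\geq3$ be a prime and $1\leq i\leq p-1$ an integer. Then $$\sum_{m=1}^{i+p}(-1)^{m-1}(m-1)!\left\{{i+p\atop m}\right\}_{\leq p-1}\equiv\frac{(-1)^{i+1}p}{i}\pmod{p^2}.$$
   Context: For integers $n\geq k\geq0$ and $r\geq1$, $\left\{{n\atop k}\right\}_{\leq r}$ denotes the $r$-restricted Stirling number of the second kind: the number of partitions of an $n$-element set into $k$ nonempty blocks each of size at most $r$; equivalently $\frac{1}{k!}\left(\sum_{m=1}^r\frac{t^m}{m!}\right)^k=\sum_{n\geq k}\left\{{n\atop k}\right\}_{\leq r}\frac{t^n}{n!}$. The congruence is in $\mathbb{Z}_{(p)}$. -}

module Defs where

open import Data.Nat using (ℕ; zero; suc; _+_; _*_; _∸_)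
open import Data.Nat using (_!)
open import Data.Nat.Combinatorics using (_C_)
open import Data.Integer as ℤ using (ℤ; +_; -_)

sumℕ : ℕ → (ℕ → ℕ) → ℕ
sumℕ zero    f = 0
sumℕ (suc r) f = sumℕ r f + f r

sumℤ1 : ℕ → (ℕ → ℤ) → ℤ
sumℤ1 zero    g = + 0
sumℤ1 (suc N) g = sumℤ1 N g ℤ.+ g (suc N)

-- Restricted Stirling numbers of the second kind, via the standard recurrence
-- obtained by removing the block containing the last element (of size j+1 ≤ r):
--   S≤r(0,0) = 1,  S≤r(0,k+1) = 0,  S≤r(n+1,0) = 0,
--   S≤r(n+1,k+1) = Σ_{j=0}^{r-1} C(n,j) · S≤r(n-j,k).
-- 'fuel' is an upper bound for n, used only to make recursion structural
-- (the invariant n ≤ fuel is maintained, so the value does not depend on it).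
stirling≤-aux : (r fuel n k : ℕ) → ℕ
stirling≤-aux r fuel       zero    zero    = 1
stirling≤-aux r fuel       zero    (suc k) = 0
stirling≤-aux r fuel       (suc n) zero    = 0
stirling≤-aux r zero       (suc n) (suc k) = 0
stirling≤-aux r (suc fuel) (suc n) (suc k) =
  sumℕ r (λ j → (n C j) * stirling≤-aux r fuel (n ∸ j) k)

stirling≤ : (r n k : ℕ) → ℕ
stirling≤ r n k = stirling≤-aux r n n k

sign : ℕ → ℤ
sign zero          = + 1
sign (suc zero)    = - (+ 1)
sign (suc (suc e)) = sign e

-- Put r = p − 1 and E(t) = Σ_{1≤j≤r} tʲ/j!. Since E(t)ᵏ/k! = Σₙ S≤r(n,k) tⁿ/n!,
-- the sum in question is the n-th coefficient (in the basis tⁿ/n!) of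
-- log(1 + E) = Σₖ (−1)ᵏ k! E^{k+1}/(k+1)!, and the neighbouring series 1/(1 + E)
-- has coefficients Σₖ (−1)ᵏ k! S≤r(n,k).  Coefficientwise,
-- (1 + E)·(1/(1 + E)) = 1 and log(1 + E)′ = E′/(1 + E), so the coefficients of
-- log(1 + E)′ solve the triangular recurrence (1 + E)·X = E′.  Because
-- 1 + E = eᵗ − O(t^{r+1}), the sequence  δₙ₀ + (−1)^{n+1+r} C(n, r)  (the
-- coefficients of (t − e^{−t}(eᵗ − 1 − E))′) solves it as well for n ≤ 2r, which
-- gives the sum for n ≤ 2r + 1.  At n = i + p it is ±C(i + r, r), and
-- i·C(i + r, r) = p·C(p + i − 1, p) with C(p + i − 1, p) ≡ 1 (mod p).

module Submission where

open import Data.Nat using (ℕ; zero; suc; _≤_; _<_; z≤n; s≤s; _∸_; _!)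
open import Data.Nat.Combinatorics using (_C_)
open import Relation.Binary.PropositionalEquality
open import Defs

module Binomial where

  open import Data.Nat using (_+_; _*_)
  open import Data.Nat.Properties
  open import Data.Nat.Combinatorics
    using (nCk≡n!/k![n-k]!; k![n∸k]!∣n!; k>n⇒nCk≡0; nCk+nC[k+1]≡[n+1]C[k+1])
  open import Data.Nat.DivMod using (m/n*n≡m)
  open import Data.Nat.Divisibility using (_∣_; m∣m*n; ∣⇒≤)
  open import Data.Nat.Primality using (Prime; euclidsLemma)
  open import Data.Nat.Tactic.RingSolver using (solve-∀)
  open import Data.Sum using (inj₁; inj₂)
  open import Relation.Nullary using (yes; no; ¬_; contradiction)
  open import Function using (_∘_)
  open ≡-Reasoning

  pascal : ∀ n k → suc n C suc k ≡ n C k + n C suc k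
  pascal n k = sym (nCk+nC[k+1]≡[n+1]C[k+1] n k)

  nCk*k![n∸k]!≡n! : ∀ {n k} → k ≤ n → (n C k) * (k ! * (n ∸ k) !) ≡ n !
  nCk*k![n∸k]!≡n! {n} {k} k≤n =
    trans (cong (_* (k ! * (n ∸ k) !)) (nCk≡n!/k![n-k]! k≤n)) (m/n*n≡m {{k !* (n ∸ k) !≢0}} (k![n∸k]!∣n! k≤n))

  ∸-comm : ∀ n a b → n ∸ a ∸ b ≡ n ∸ b ∸ a
  ∸-comm n a b = begin
    n ∸ a ∸ b   ≡⟨ ∸-+-assoc n a b ⟩
    n ∸ (a + b) ≡⟨ cong (n ∸_) (+-comm a b) ⟩
    n ∸ (b + a) ≡⟨ ∸-+-assoc n b a ⟨
    n ∸ b ∸ a   ∎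

  nCa*[n∸a]Cb*a!b!c!≡n! : ∀ {n} a b → a + b ≤ n →
    (n C a) * ((n ∸ a) C b) * (a ! * (b ! * (n ∸ a ∸ b) !)) ≡ n !
  nCa*[n∸a]Cb*a!b!c!≡n! {n} a b a+b≤n = begin
    (n C a) * ((n ∸ a) C b) * (a ! * (b ! * (n ∸ a ∸ b) !))
      ≡⟨ rearrange (n C a) ((n ∸ a) C b) (a !) (b ! * (n ∸ a ∸ b) !) ⟩
    (n C a) * (a ! * (((n ∸ a) C b) * (b ! * (n ∸ a ∸ b) !)))
      ≡⟨ cong (λ x → (n C a) * (a ! * x)) (nCk*k![n∸k]!≡n! b≤n∸a) ⟩
    (n C a) * (a ! * (n ∸ a) !)
      ≡⟨ nCk*k![n∸k]!≡n! (m+n≤o⇒m≤o a a+b≤n) ⟩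
    n ! ∎
    where
    b≤n∸a : b ≤ n ∸ a
    b≤n∸a = subst (_≤ n ∸ a) (m+n∸m≡n a b) (∸-monoˡ-≤ a a+b≤n)
    rearrange : ∀ x y u v → x * y * (u * v) ≡ x * (u * (y * v))
    rearrange = solve-∀

  nCa*[n∸a]Cb≡0 : ∀ {n a b} → ¬ (a + b ≤ n) → (n C a) * ((n ∸ a) C b) ≡ 0
  nCa*[n∸a]Cb≡0 {n} {a} {b} a+b≰n with a ≤? n
  ... | no  a≰n = cong (_* ((n ∸ a) C b)) (k>n⇒nCk≡0 (≰⇒> a≰n))
  ... | yes a≤n with b ≤? n ∸ a
  ...   | no  b≰n∸a = trans (cong ((n C a) *_) (k>n⇒nCk≡0 (≰⇒> b≰n∸a))) (*-zeroʳ (n C a))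
  ...   | yes b≤n∸a = contradiction (subst (a + b ≤_) (m+[n∸m]≡n a≤n) (+-monoʳ-≤ a b≤n∸a)) a+b≰n

  nCa*[n∸a]Cb≡nCb*[n∸b]Ca : ∀ n a b → (n C a) * ((n ∸ a) C b) ≡ (n C b) * ((n ∸ b) C a)
  nCa*[n∸a]Cb≡nCb*[n∸b]Ca n a b with a + b ≤? n
  ... | no  a+b≰n = trans (nCa*[n∸a]Cb≡0 {n} {a} a+b≰n) (sym (nCa*[n∸a]Cb≡0 {n} {b} (a+b≰n ∘ subst (_≤ n) (+-comm b a))))
  ... | yes a+b≤n = *-cancelʳ-≡ _ _ (a ! * (b ! * (n ∸ a ∸ b) !)) {{m*n≢0 (a !) _ {{a !≢0}} {{b !* (n ∸ a ∸ b) !≢0}}}} (begin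
    (n C a) * ((n ∸ a) C b) * (a ! * (b ! * (n ∸ a ∸ b) !))
      ≡⟨ nCa*[n∸a]Cb*a!b!c!≡n! a b a+b≤n ⟩
    n !
      ≡⟨ nCa*[n∸a]Cb*a!b!c!≡n! b a (subst (_≤ n) (+-comm a b) a+b≤n) ⟨
    (n C b) * ((n ∸ b) C a) * (b ! * (a ! * (n ∸ b ∸ a) !))
      ≡⟨ cong (λ c → (n C b) * ((n ∸ b) C a) * (b ! * (a ! * c !))) (∸-comm n b a) ⟩
    (n C b) * ((n ∸ b) C a) * (b ! * (a ! * (n ∸ a ∸ b) !))
      ≡⟨ cong ((n C b) * ((n ∸ b) C a) *_) (x∙yz≈y∙xz (b !) (a !) _) ⟩
    (n C b) * ((n ∸ b) C a) * (a ! * (b ! * (n ∸ a ∸ b) !)) ∎)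
    where open import Algebra.Properties.CommutativeSemigroup *-commutativeSemigroup using (x∙yz≈y∙xz)

  [1+k]*[1+n]C[1+k]≡[1+n]*nCk : ∀ n k → suc k * (suc n C suc k) ≡ suc n * (n C k)
  [1+k]*[1+n]C[1+k]≡[1+n]*nCk n k with k ≤? n
  ... | no  k≰n = begin
    suc k * (suc n C suc k) ≡⟨ cong (suc k *_) (k>n⇒nCk≡0 (s≤s (≰⇒> k≰n))) ⟩
    suc k * 0               ≡⟨ *-zeroʳ (suc k) ⟩
    0                       ≡⟨ *-zeroʳ (suc n) ⟨
    suc n * 0               ≡⟨ cong (suc n *_) (k>n⇒nCk≡0 (≰⇒> k≰n)) ⟨
    suc n * (n C k)         ∎
  ... | yes k≤n = *-cancelʳ-≡ _ _ (k ! * (n ∸ k) !) {{k !* (n ∸ k) !≢0}} (begin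
    suc k * (suc n C suc k) * (k ! * (n ∸ k) !)   ≡⟨ rearrange (suc k) (suc n C suc k) (k !) ((n ∸ k) !) ⟩
    (suc n C suc k) * (suc k ! * (suc n ∸ suc k) !) ≡⟨ nCk*k![n∸k]!≡n! (s≤s k≤n) ⟩
    suc n !                                         ≡⟨ cong (suc n *_) (nCk*k![n∸k]!≡n! k≤n) ⟨
    suc n * ((n C k) * (k ! * (n ∸ k) !))           ≡⟨ *-assoc (suc n) (n C k) _ ⟨
    suc n * (n C k) * (k ! * (n ∸ k) !)             ∎)
    where
    rearrange : ∀ s x u v → s * x * (u * v) ≡ x * (s * u * v)
    rearrange = solve-∀

  d*[k+d]Ck≡[1+k]*[k+d]C[1+k] : ∀ k d → d * ((k + d) C k) ≡ suc k * ((k + d) C suc k)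
  d*[k+d]Ck≡[1+k]*[k+d]C[1+k] k d = +-cancelˡ-≡ (suc k * (n C k)) _ _ (begin
    suc k * (n C k) + d * (n C k)        ≡⟨ *-distribʳ-+ (n C k) (suc k) d ⟨
    (suc k + d) * (n C k)                ≡⟨ [1+k]*[1+n]C[1+k]≡[1+n]*nCk n k ⟨
    suc k * (suc n C suc k)              ≡⟨ cong (suc k *_) (pascal n k) ⟩
    suc k * ((n C k) + (n C suc k))      ≡⟨ *-distribˡ-+ (suc k) (n C k) (n C suc k) ⟩
    suc k * (n C k) + suc k * (n C suc k) ∎)
    where n = k + d

  -- Since p = 1 + r is prime and does not divide 1 + c, it divides the
  -- other side of  (1 + c) · C(p + c, r) = p · C(p + c, p).
  [1+r]∣[1+r+c]Cr : ∀ r c → Prime (suc r) → c < r → suc r ∣ (suc r + c) C r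
  [1+r]∣[1+r+c]Cr r c p-prime c<r with euclidsLemma (suc c) ((suc r + c) C r) p-prime p∣[1+c]*C
    where
    p∣[1+c]*C : suc r ∣ suc c * ((suc r + c) C r)
    p∣[1+c]*C = subst (λ m → suc r ∣ suc c * (m C r)) (+-suc r c)
                  (subst (suc r ∣_) (sym (d*[k+d]Ck≡[1+k]*[k+d]C[1+k] r (suc c))) (m∣m*n _))
  ... | inj₁ p∣1+c = contradiction (∣⇒≤ p∣1+c) (<⇒≱ (s≤s c<r))
  ... | inj₂ p∣C   = p∣C

module FiniteSums where

  open import Data.Nat as ℕ using ()
  open import Data.Nat.Properties as ℕ using (≤-refl; <⇒≤; m<n⇒m<1+n; m≤n⇒m<n∨m≡n; <-cmp; n∸n≡0; +-∸-assoc)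
  open import Data.Integer using (ℤ; +_; -_; _+_; _*_)
  open import Data.Integer.Properties
    using (+-identityˡ; +-identityʳ; +-assoc; *-assoc; *-zeroʳ; *-identityˡ; *-identityʳ; *-distribˡ-+;
           pos-+; pos-*; neg-involutive; -1*i≡-i)
  open import Data.Integer.Tactic.RingSolver using (solve-∀)
  open import Data.Nat.Combinatorics using (nCn≡1; k>n⇒nCk≡0)
  open import Data.Sum using (inj₁; inj₂)
  open Binomial using (pascal; ∸-comm; nCa*[n∸a]Cb≡nCb*[n∸b]Ca)
  open import Relation.Binary.Definitions using (tri<; tri≈; tri>)
  open ≡-Reasoning

  Σ : ℕ → (ℕ → ℤ) → ℤ
  Σ zero    g = + 0
  Σ (suc K) g = Σ K g + g K

  Σ-cong : ∀ K {g h : ℕ → ℤ} → (∀ j → j < K → g j ≡ h j) → Σ K g ≡ Σ K h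
  Σ-cong zero    g≗h = refl
  Σ-cong (suc K) g≗h = cong₂ _+_ (Σ-cong K (λ j j<K → g≗h j (m<n⇒m<1+n j<K))) (g≗h K ≤-refl)

  Σ-zero : ∀ K {g : ℕ → ℤ} → (∀ j → j < K → g j ≡ + 0) → Σ K g ≡ + 0
  Σ-zero zero    g≗0 = refl
  Σ-zero (suc K) g≗0 = cong₂ _+_ (Σ-zero K (λ j j<K → g≗0 j (m<n⇒m<1+n j<K))) (g≗0 K ≤-refl)

  Σ-distrib-+ : ∀ K (g h : ℕ → ℤ) → Σ K (λ j → g j + h j) ≡ Σ K g + Σ K h
  Σ-distrib-+ zero    g h = refl
  Σ-distrib-+ (suc K) g h = trans (cong (_+ (g K + h K)) (Σ-distrib-+ K g h)) (+-interchange (Σ K g) _ _ _)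
    where
    +-interchange : ∀ a b c d → a + b + (c + d) ≡ a + c + (b + d)
    +-interchange = solve-∀

  *-distribˡ-Σ : ∀ K c (g : ℕ → ℤ) → c * Σ K g ≡ Σ K (λ j → c * g j)
  *-distribˡ-Σ zero    c g = *-zeroʳ c
  *-distribˡ-Σ (suc K) c g = trans (*-distribˡ-+ c (Σ K g) (g K)) (cong (_+ c * g K) (*-distribˡ-Σ K c g))

  Σ-comm : ∀ K L (f : ℕ → ℕ → ℤ) → Σ K (λ j → Σ L (f j)) ≡ Σ L (λ l → Σ K (λ j → f j l))
  Σ-comm zero    L f = sym (Σ-zero L (λ _ _ → refl))
  Σ-comm (suc K) L f = trans (cong (_+ Σ L (f K)) (Σ-comm K L f)) (sym (Σ-distrib-+ L _ (f K)))

  Σ-head : ∀ K (g : ℕ → ℤ) → Σ (suc K) g ≡ g 0 + Σ K (λ j → g (suc j))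
  Σ-head zero    g = trans (+-identityˡ (g 0)) (sym (+-identityʳ (g 0)))
  Σ-head (suc K) g = trans (cong (_+ g (suc K)) (Σ-head K g)) (+-assoc (g 0) _ _)

  Σ-truncate : ∀ M K {g : ℕ → ℤ} → M ≤ K → (∀ j → M ≤ j → g j ≡ + 0) → Σ K g ≡ Σ M g
  Σ-truncate M zero    z≤n  g≗0 = refl
  Σ-truncate M (suc K) M≤1+K g≗0 with m≤n⇒m<n∨m≡n M≤1+K
  ... | inj₁ (s≤s M≤K) = trans (cong₂ _+_ (Σ-truncate M K M≤K g≗0) (g≗0 K M≤K)) (+-identityʳ _)
  ... | inj₂ refl      = refl

  sumℕ≡Σ : ∀ K (f : ℕ → ℕ) → + sumℕ K f ≡ Σ K (λ j → + f j)
  sumℕ≡Σ zero    f = refl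
  sumℕ≡Σ (suc K) f = trans (pos-+ (sumℕ K f) (f K)) (cong (_+ + f K) (sumℕ≡Σ K f))

  sumℤ1≡Σ : ∀ N (g : ℕ → ℤ) → sumℤ1 N g ≡ Σ N (λ k → g (suc k))
  sumℤ1≡Σ zero    g = refl
  sumℤ1≡Σ (suc N) g = cong (_+ g (suc N)) (sumℤ1≡Σ N g)

  δ : ℕ → ℤ
  δ zero    = + 1
  δ (suc _) = + 0

  𝟙[_<_] : ℕ → ℕ → ℤ
  𝟙[ n     < zero  ] = + 0
  𝟙[ zero  < suc K ] = + 1
  𝟙[ suc n < suc K ] = 𝟙[ n < K ]

  𝟙[<]-yes : ∀ {n K} → n < K → 𝟙[ n < K ] ≡ + 1
  𝟙[<]-yes {zero}  (s≤s _)   = refl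
  𝟙[<]-yes {suc n} (s≤s n<K) = 𝟙[<]-yes n<K

  𝟙[<]-no : ∀ {n K} → K ≤ n → 𝟙[ n < K ] ≡ + 0
  𝟙[<]-no {n}     z≤n       = refl
  𝟙[<]-no {suc n} (s≤s K≤n) = 𝟙[<]-no K≤n

  Σ-C*δ : ∀ K n → Σ K (λ l → + (n C l) * δ (n ∸ l)) ≡ 𝟙[ n < K ]
  Σ-C*δ zero    n = sym (𝟙[<]-no {n} z≤n)
  Σ-C*δ (suc K) n with <-cmp n K
  ... | tri< n<K _ _ = begin
    Σ K (λ l → + (n C l) * δ (n ∸ l)) + + (n C K) * δ (n ∸ K) ≡⟨ cong₂ _+_ (Σ-C*δ K n) (cong (λ c → + c * δ (n ∸ K)) (k>n⇒nCk≡0 n<K)) ⟩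
    𝟙[ n < K ] + + 0                                          ≡⟨ cong (_+ + 0) (𝟙[<]-yes n<K) ⟩
    + 1                                                       ≡⟨ 𝟙[<]-yes (m<n⇒m<1+n n<K) ⟨
    𝟙[ n < suc K ]                                            ∎
  ... | tri≈ _ refl _ = begin
    Σ n (λ l → + (n C l) * δ (n ∸ l)) + + (n C n) * δ (n ∸ n) ≡⟨ cong₂ _+_ (Σ-C*δ n n) (cong₂ (λ c m → + c * δ m) (nCn≡1 n) (n∸n≡0 n)) ⟩
    𝟙[ n < n ] + + 1                                          ≡⟨ cong (_+ + 1) (𝟙[<]-no {n} ≤-refl) ⟩
    + 1                                                       ≡⟨ 𝟙[<]-yes {n} ≤-refl ⟨
    𝟙[ n < suc n ]                                            ∎
  ... | tri> _ _ K<n = begin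
    Σ K (λ l → + (n C l) * δ (n ∸ l)) + + (n C K) * δ (n ∸ K) ≡⟨ cong₂ _+_ (Σ-C*δ K n) (cong (λ m → + (n C K) * δ m) (+-∸-assoc 1 K<n)) ⟩
    𝟙[ n < K ] + + (n C K) * + 0                              ≡⟨ cong₂ _+_ (𝟙[<]-no (<⇒≤ K<n)) (*-zeroʳ (+ (n C K))) ⟩
    + 0                                                       ≡⟨ 𝟙[<]-no K<n ⟨
    𝟙[ n < suc K ]                                            ∎

  sign-suc : ∀ k → sign (suc k) ≡ - sign k
  sign-suc zero    = refl
  sign-suc (suc k) = trans (sym (neg-involutive (sign k))) (cong -_ (sym (sign-suc k)))

  sign-+ : ∀ a b → sign (a ℕ.+ b) ≡ sign a * sign b
  sign-+ zero          b = sym (*-identityˡ (sign b))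
  sign-+ (suc zero)    b = trans (sign-suc b) (sym (-1*i≡-i (sign b)))
  sign-+ (suc (suc a)) b = sign-+ a b

  sign*sign≡1 : ∀ a → sign a * sign a ≡ + 1
  sign*sign≡1 zero          = refl
  sign*sign≡1 (suc zero)    = refl
  sign*sign≡1 (suc (suc a)) = sign*sign≡1 a

  sign[n+n]≡1 : ∀ n → sign (n ℕ.+ n) ≡ + 1
  sign[n+n]≡1 n = trans (sign-+ n n) (sign*sign≡1 n)

  sign[a+[n+n]]≡sign[a] : ∀ a n → sign (a ℕ.+ (n ℕ.+ n)) ≡ sign a
  sign[a+[n+n]]≡sign[a] a n = trans (sign-+ a (n ℕ.+ n)) (trans (cong (sign a *_) (sign[n+n]≡1 n)) (*-identityʳ (sign a)))

  sign[a+b]*sign[b]≡sign[a] : ∀ a b → sign (a ℕ.+ b) * sign b ≡ sign a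
  sign[a+b]*sign[b]≡sign[a] a b = begin
    sign (a ℕ.+ b) * sign b      ≡⟨ cong (_* sign b) (sign-+ a b) ⟩
    sign a * sign b * sign b     ≡⟨ *-assoc (sign a) (sign b) (sign b) ⟩
    sign a * (sign b * sign b)   ≡⟨ cong (sign a *_) (sign*sign≡1 b) ⟩
    sign a * + 1                 ≡⟨ *-identityʳ (sign a) ⟩
    sign a                       ∎

  Σ-sign*C : ∀ N k → Σ (suc k) (λ j → sign j * + (suc N C j)) ≡ sign k * + (N C k)
  Σ-sign*C N zero    = refl
  Σ-sign*C N (suc k) = begin
    Σ (suc k) (λ j → sign j * + (suc N C j)) + sign (suc k) * + (suc N C suc k)
      ≡⟨ cong₂ (λ a b → a + sign (suc k) * + b) (Σ-sign*C N k) (pascal N k) ⟩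
    sign k * + (N C k) + sign (suc k) * + ((N C k) ℕ.+ (N C suc k))
      ≡⟨ cong₂ (λ s b → sign k * + (N C k) + s * b) (sign-suc k) (pos-+ (N C k) (N C suc k)) ⟩
    sign k * + (N C k) + - sign k * (+ (N C k) + + (N C suc k))
      ≡⟨ telescope (sign k) (+ (N C k)) (+ (N C suc k)) ⟩
    - sign k * + (N C suc k)
      ≡⟨ cong (_* + (N C suc k)) (sign-suc k) ⟨
    sign (suc k) * + (N C suc k) ∎
    where
    telescope : ∀ s a b → s * a + - s * (a + b) ≡ - s * b
    telescope = solve-∀

  Σ-sign*C≡δ : ∀ N k → N ≤ k → Σ (suc k) (λ j → sign j * + (N C j)) ≡ δ N
  Σ-sign*C≡δ zero    k _ = trans (Σ-head k _) (cong (_+_ (+ 1)) (Σ-zero k (λ j _ → *-zeroʳ (sign (suc j)))))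
  Σ-sign*C≡δ (suc N) k N<k = trans (Σ-sign*C N k) (trans (cong (λ c → sign k * + c) (k>n⇒nCk≡0 N<k)) (*-zeroʳ (sign k)))

  Σ-C*Σ-C-comm : ∀ n J L (a b : ℕ → ℕ) (g : ℕ → ℤ) →
    Σ J (λ j → + (n C a j) * Σ L (λ l → + ((n ∸ a j) C b l) * g (n ∸ a j ∸ b l))) ≡
    Σ L (λ l → + (n C b l) * Σ J (λ j → + ((n ∸ b l) C a j) * g (n ∸ b l ∸ a j)))
  Σ-C*Σ-C-comm n J L a b g = begin
    Σ J (λ j → + (n C a j) * Σ L (λ l → + ((n ∸ a j) C b l) * g (n ∸ a j ∸ b l)))
      ≡⟨ Σ-cong J (λ j _ → *-distribˡ-Σ L (+ (n C a j)) (λ l → + ((n ∸ a j) C b l) * g (n ∸ a j ∸ b l))) ⟩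
    Σ J (λ j → Σ L (λ l → + (n C a j) * (+ ((n ∸ a j) C b l) * g (n ∸ a j ∸ b l))))
      ≡⟨ Σ-cong J (λ j _ → Σ-cong L (λ l _ → choose-in-either-order (a j) (b l))) ⟩
    Σ J (λ j → Σ L (λ l → + (n C b l) * (+ ((n ∸ b l) C a j) * g (n ∸ b l ∸ a j))))
      ≡⟨ Σ-comm J L _ ⟩
    Σ L (λ l → Σ J (λ j → + (n C b l) * (+ ((n ∸ b l) C a j) * g (n ∸ b l ∸ a j))))
      ≡⟨ Σ-cong L (λ l _ → *-distribˡ-Σ J (+ (n C b l)) (λ j → + ((n ∸ b l) C a j) * g (n ∸ b l ∸ a j))) ⟨
    Σ L (λ l → + (n C b l) * Σ J (λ j → + ((n ∸ b l) C a j) * g (n ∸ b l ∸ a j))) ∎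
    where
    choose-in-either-order : ∀ x y →
      + (n C x) * (+ ((n ∸ x) C y) * g (n ∸ x ∸ y)) ≡ + (n C y) * (+ ((n ∸ y) C x) * g (n ∸ y ∸ x))
    choose-in-either-order x y = begin
      + (n C x) * (+ ((n ∸ x) C y) * g (n ∸ x ∸ y))   ≡⟨ *-assoc (+ (n C x)) _ _ ⟨
      + (n C x) * + ((n ∸ x) C y) * g (n ∸ x ∸ y)     ≡⟨ cong₂ _*_ (pos-* (n C x) _) (cong g (∸-comm n y x)) ⟨
      + ((n C x) ℕ.* ((n ∸ x) C y)) * g (n ∸ y ∸ x)   ≡⟨ cong (λ c → + c * g (n ∸ y ∸ x)) (nCa*[n∸a]Cb≡nCb*[n∸b]Ca n x y) ⟩
      + ((n C y) ℕ.* ((n ∸ y) C x)) * g (n ∸ y ∸ x)   ≡⟨ cong (_* g (n ∸ y ∸ x)) (pos-* (n C y) _) ⟩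
      + (n C y) * + ((n ∸ y) C x) * g (n ∸ y ∸ x)     ≡⟨ *-assoc (+ (n C y)) _ _ ⟩
      + (n C y) * (+ ((n ∸ y) C x) * g (n ∸ y ∸ x))   ∎

module RestrictedStirling (r : ℕ) where

  open import Data.Nat as ℕ using ()
  open import Data.Nat.Properties as ℕ
    using (≤-refl; ≤-trans; ≤-<-trans; <⇒≤; m∸n≤m; ≤-<-connex; <-cmp; +-∸-assoc; n<1+n; m<n⇒m<1+n;
           m≤n⇒m<n∨m≡n; ∸-monoʳ-<; m∸n+n≡m; m≤n+o⇒m∸n≤o; n∸n≡0)
  open import Data.Nat.Induction using (<-rec)
  open import Data.Nat.Combinatorics using (k>n⇒nCk≡0; nCn≡1)
  open import Data.Integer using (ℤ; +_; -_; _+_; _*_)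
  open import Data.Integer.Properties
    using (+-assoc; +-identityˡ; +-identityʳ; *-identityˡ; *-zeroˡ; *-zeroʳ; *-distribˡ-+; *-distribʳ-+;
           pos-+; pos-*; *-commutativeSemigroup; +-0-abelianGroup)
  open import Data.Integer.Tactic.RingSolver using (solve-∀)
  open import Data.Sum using (inj₁; inj₂)
  open import Algebra.Properties.CommutativeSemigroup *-commutativeSemigroup using (x∙yz≈y∙xz)
  open import Algebra.Properties.AbelianGroup +-0-abelianGroup using (∙-cancelʳ)
  open import Relation.Binary.Definitions using (tri<; tri≈; tri>)
  open Binomial using (pascal; nCa*[n∸a]Cb≡nCb*[n∸b]Ca; d*[k+d]Ck≡[1+k]*[k+d]C[1+k])
  open FiniteSums
  open ≡-Reasoning

  private
    sumℕ-cong : ∀ K {f g : ℕ → ℕ} → (∀ j → f j ≡ g j) → sumℕ K f ≡ sumℕ K g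
    sumℕ-cong zero    f≗g = refl
    sumℕ-cong (suc K) f≗g = cong₂ ℕ._+_ (sumℕ-cong K f≗g) (f≗g K)

  stirling≤-aux-fuel : ∀ fuel fuel′ n k → n ≤ fuel → n ≤ fuel′ →
    stirling≤-aux r fuel n k ≡ stirling≤-aux r fuel′ n k
  stirling≤-aux-fuel fuel       fuel′       zero    zero    _ _ = refl
  stirling≤-aux-fuel fuel       fuel′       zero    (suc k) _ _ = refl
  stirling≤-aux-fuel fuel       fuel′       (suc n) zero    _ _ = refl
  stirling≤-aux-fuel (suc fuel) (suc fuel′) (suc n) (suc k) (s≤s n≤f) (s≤s n≤f′) =
    sumℕ-cong r (λ j → cong ((n C j) ℕ.*_)
      (stirling≤-aux-fuel fuel fuel′ (n ∸ j) k (≤-trans (m∸n≤m n j) n≤f) (≤-trans (m∸n≤m n j) n≤f′)))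

  S : ℕ → ℕ → ℤ
  S n k = + stirling≤ r n k

  S-zero : ∀ n → S n 0 ≡ δ n
  S-zero zero    = refl
  S-zero (suc n) = refl

  S-suc : ∀ n k → S (suc n) (suc k) ≡ Σ r (λ j → + (n C j) * S (n ∸ j) k)
  S-suc n k = begin
    + sumℕ r (λ j → (n C j) ℕ.* stirling≤-aux r n (n ∸ j) k)
      ≡⟨ cong +_ (sumℕ-cong r (λ j → cong ((n C j) ℕ.*_) (stirling≤-aux-fuel n (n ∸ j) (n ∸ j) k (m∸n≤m n j) ≤-refl))) ⟩
    + sumℕ r (λ j → (n C j) ℕ.* stirling≤ r (n ∸ j) k)
      ≡⟨ sumℕ≡Σ r _ ⟩
    Σ r (λ j → + ((n C j) ℕ.* stirling≤ r (n ∸ j) k))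
      ≡⟨ Σ-cong r (λ j _ → pos-* (n C j) _) ⟩
    Σ r (λ j → + (n C j) * S (n ∸ j) k) ∎

  S-vanish : ∀ n k → n < k → S n k ≡ + 0
  S-vanish zero    (suc k) _         = refl
  S-vanish (suc n) (suc k) (s≤s n<k) = trans (S-suc n k) (Σ-zero r λ j _ →
    trans (cong (+ (n C j) *_) (S-vanish (n ∸ j) k (≤-<-trans (m∸n≤m n j) n<k))) (*-zeroʳ (+ (n C j))))

  private
    C[n,1+j]*S-suc : ∀ n j k → + (n C suc j) * S (n ∸ j) (suc k) ≡
      + (n C suc j) * Σ r (λ l → + ((n ∸ suc j) C l) * S (n ∸ suc j ∸ l) k)
    C[n,1+j]*S-suc n j k with ≤-<-connex (suc j) n
    ... | inj₁ j<n rewrite +-∸-assoc 1 j<n = cong (+ (n C suc j) *_) (S-suc (n ∸ suc j) k)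
    ... | inj₂ n<1+j rewrite k>n⇒nCk≡0 n<1+j = refl

    C[n,1+j]*S-zero : ∀ n j → + (n C suc j) * S (n ∸ j) 0 ≡ + 0
    C[n,1+j]*S-zero n j with ≤-<-connex (suc j) n
    ... | inj₁ j<n rewrite +-∸-assoc 1 j<n = *-zeroʳ (+ (n C suc j))
    ... | inj₂ n<1+j rewrite k>n⇒nCk≡0 n<1+j = refl

  -- (1 + k) · S(n, 1 + k) counts partitions with one of the 1 + k blocks
  -- marked; j + 1 is the size of the marked block.
  MarkedBlock : ℕ → Set
  MarkedBlock n = ∀ k → Σ r (λ j → + (n C suc j) * S (n ∸ suc j) k) ≡ + suc k * S n (suc k)

  Σ-C[n,1+j]*S[n∸j] : ∀ n → (∀ {m} → m ≤ n → MarkedBlock m) →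
    ∀ k → Σ r (λ j → + (n C suc j) * S (n ∸ j) k) ≡ + k * S (suc n) (suc k)
  Σ-C[n,1+j]*S[n∸j] n marked zero    = trans (Σ-zero r (λ j _ → C[n,1+j]*S-zero n j)) (sym (*-zeroˡ (S (suc n) 1)))
  Σ-C[n,1+j]*S[n∸j] n marked (suc k) = begin
    Σ r (λ j → + (n C suc j) * S (n ∸ j) (suc k))
      ≡⟨ Σ-cong r (λ j _ → C[n,1+j]*S-suc n j k) ⟩
    Σ r (λ j → + (n C suc j) * Σ r (λ l → + ((n ∸ suc j) C l) * S (n ∸ suc j ∸ l) k))
      ≡⟨ Σ-C*Σ-C-comm n r r suc (λ l → l) (λ m → S m k) ⟩
    Σ r (λ l → + (n C l) * Σ r (λ j → + ((n ∸ l) C suc j) * S (n ∸ l ∸ suc j) k))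
      ≡⟨ Σ-cong r (λ l _ → cong (+ (n C l) *_) (marked (m∸n≤m n l) k)) ⟩
    Σ r (λ l → + (n C l) * (+ suc k * S (n ∸ l) (suc k)))
      ≡⟨ Σ-cong r (λ l _ → x*[y*z]≡y*[x*z] (+ (n C l)) (+ suc k) _) ⟩
    Σ r (λ l → + suc k * (+ (n C l) * S (n ∸ l) (suc k)))
      ≡⟨ *-distribˡ-Σ r (+ suc k) _ ⟨
    + suc k * Σ r (λ l → + (n C l) * S (n ∸ l) (suc k))
      ≡⟨ cong (+ suc k *_) (S-suc n (suc k)) ⟨
    + suc k * S (suc n) (suc (suc k)) ∎
    where
    x*[y*z]≡y*[x*z] : ∀ x y z → x * (y * z) ≡ y * (x * z)
    x*[y*z]≡y*[x*z] = solve-∀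

  Σ-C[n,1+j]*S : ∀ n → MarkedBlock n
  Σ-C[n,1+j]*S = <-rec MarkedBlock marked
    where
    marked : ∀ n → (∀ {m} → m < n → MarkedBlock m) → MarkedBlock n
    marked zero    _  k = trans (Σ-zero r (λ j _ → refl)) (sym (*-zeroʳ (+ suc k)))
    marked (suc n) ih k = begin
      Σ r (λ j → + (suc n C suc j) * S (n ∸ j) k)
        ≡⟨ Σ-cong r (λ j _ → pascal-split j) ⟩
      Σ r (λ j → + (n C j) * S (n ∸ j) k + + (n C suc j) * S (n ∸ j) k)
        ≡⟨ Σ-distrib-+ r _ _ ⟩
      Σ r (λ j → + (n C j) * S (n ∸ j) k) + Σ r (λ j → + (n C suc j) * S (n ∸ j) k)
        ≡⟨ cong₂ _+_ (sym (S-suc n k)) (Σ-C[n,1+j]*S[n∸j] n (λ m≤n → ih (s≤s m≤n)) k) ⟩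
      S (suc n) (suc k) + + k * S (suc n) (suc k)
        ≡⟨ x+k*x≡[1+k]*x (+ k) _ ⟩
      + suc k * S (suc n) (suc k) ∎
      where
      pascal-split : ∀ j → + (suc n C suc j) * S (n ∸ j) k ≡ + (n C j) * S (n ∸ j) k + + (n C suc j) * S (n ∸ j) k
      pascal-split j = begin
        + (suc n C suc j) * S (n ∸ j) k                      ≡⟨ cong (λ c → + c * S (n ∸ j) k) (pascal n j) ⟩
        + ((n C j) ℕ.+ (n C suc j)) * S (n ∸ j) k             ≡⟨ cong (_* S (n ∸ j) k) (pos-+ (n C j) (n C suc j)) ⟩
        (+ (n C j) + + (n C suc j)) * S (n ∸ j) k             ≡⟨ *-distribʳ-+ (S (n ∸ j) k) (+ (n C j)) (+ (n C suc j)) ⟩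
        + (n C j) * S (n ∸ j) k + + (n C suc j) * S (n ∸ j) k ∎
      x+k*x≡[1+k]*x : ∀ k x → x + k * x ≡ (+ 1 + k) * x
      x+k*x≡[1+k]*x = solve-∀

  recipTerm : ℕ → ℕ → ℤ
  recipTerm m k = sign k * + (k !) * S m k

  recipCoeff : ℕ → ℤ
  recipCoeff m = Σ (suc m) (recipTerm m)

  logCoeff : ℕ → ℤ
  logCoeff n = Σ n (λ k → sign k * + (k !) * S n (suc k))

  mulE′ : (ℕ → ℤ) → ℕ → ℤ
  mulE′ x n = Σ r (λ l → + (n C l) * x (n ∸ l))

  mul1+E : (ℕ → ℤ) → ℕ → ℤ
  mul1+E x n = Σ (suc r) (λ j → + (n C j) * x (n ∸ j))

  Σ-recipTerm-truncate : ∀ {m} K → m < K → Σ K (recipTerm m) ≡ recipCoeff m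
  Σ-recipTerm-truncate {m} K m<K = Σ-truncate (suc m) K m<K λ k m<k →
    trans (cong (sign k * + (k !) *_) (S-vanish m k m<k)) (*-zeroʳ (sign k * + (k !)))

  logCoeff-suc : ∀ n → logCoeff (suc n) ≡ mulE′ recipCoeff n
  logCoeff-suc n = begin
    Σ (suc n) (λ k → sign k * + (k !) * S (suc n) (suc k))
      ≡⟨ Σ-cong (suc n) (λ k _ → trans (cong (sign k * + (k !) *_) (S-suc n k)) (*-distribˡ-Σ r (sign k * + (k !)) (λ l → + (n C l) * S (n ∸ l) k))) ⟩
    Σ (suc n) (λ k → Σ r (λ l → sign k * + (k !) * (+ (n C l) * S (n ∸ l) k)))
      ≡⟨ Σ-comm (suc n) r _ ⟩
    Σ r (λ l → Σ (suc n) (λ k → sign k * + (k !) * (+ (n C l) * S (n ∸ l) k)))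
      ≡⟨ Σ-cong r (λ l _ → trans (Σ-cong (suc n) (λ k _ → x∙yz≈y∙xz (sign k * + (k !)) (+ (n C l)) (S (n ∸ l) k))) (sym (*-distribˡ-Σ (suc n) (+ (n C l)) (recipTerm (n ∸ l))))) ⟩
    Σ r (λ l → + (n C l) * Σ (suc n) (recipTerm (n ∸ l)))
      ≡⟨ Σ-cong r (λ l _ → cong (+ (n C l) *_) (Σ-recipTerm-truncate (suc n) (s≤s (m∸n≤m n l)))) ⟩
    mulE′ recipCoeff n ∎

  mul1+E-head : ∀ x n → mul1+E x n ≡ x n + Σ r (λ j → + (n C suc j) * x (n ∸ suc j))
  mul1+E-head x n = trans (Σ-head r _) (cong (_+ Σ r (λ j → + (n C suc j) * x (n ∸ suc j))) (*-identityˡ (x n)))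

  Σ-C[n,1+j]*recipCoeff : ∀ m → Σ r (λ j → + (m C suc j) * recipCoeff (m ∸ suc j)) ≡
    Σ (suc m) (λ k → sign k * + (k !) * (+ suc k * S m (suc k)))
  Σ-C[n,1+j]*recipCoeff m = begin
    Σ r (λ j → + (m C suc j) * recipCoeff (m ∸ suc j))
      ≡⟨ Σ-cong r (λ j _ → cong (+ (m C suc j) *_) (Σ-recipTerm-truncate (suc m) (s≤s (m∸n≤m m (suc j))))) ⟨
    Σ r (λ j → + (m C suc j) * Σ (suc m) (recipTerm (m ∸ suc j)))
      ≡⟨ Σ-cong r (λ j _ → *-distribˡ-Σ (suc m) (+ (m C suc j)) (recipTerm (m ∸ suc j))) ⟩
    Σ r (λ j → Σ (suc m) (λ k → + (m C suc j) * (sign k * + (k !) * S (m ∸ suc j) k)))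
      ≡⟨ Σ-comm r (suc m) _ ⟩
    Σ (suc m) (λ k → Σ r (λ j → + (m C suc j) * (sign k * + (k !) * S (m ∸ suc j) k)))
      ≡⟨ Σ-cong (suc m) (λ k _ → trans (Σ-cong r (λ j _ → x∙yz≈y∙xz (+ (m C suc j)) (sign k * + (k !)) (S (m ∸ suc j) k)))
                                       (sym (*-distribˡ-Σ r (sign k * + (k !)) (λ j → + (m C suc j) * S (m ∸ suc j) k)))) ⟩
    Σ (suc m) (λ k → sign k * + (k !) * Σ r (λ j → + (m C suc j) * S (m ∸ suc j) k))
      ≡⟨ Σ-cong (suc m) (λ k _ → cong (sign k * + (k !) *_) (Σ-C[n,1+j]*S m k)) ⟩
    Σ (suc m) (λ k → sign k * + (k !) * (+ suc k * S m (suc k))) ∎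

  recipTerm-suc-cancel : ∀ m k → recipTerm m (suc k) + sign k * + (k !) * (+ suc k * S m (suc k)) ≡ + 0
  recipTerm-suc-cancel m k = begin
    sign (suc k) * + (suc k ℕ.* k !) * S m (suc k) + sign k * + (k !) * (+ suc k * S m (suc k))
      ≡⟨ cong₂ (λ s f → s * f * S m (suc k) + sign k * + (k !) * (+ suc k * S m (suc k))) (sign-suc k) (pos-* (suc k) (k !)) ⟩
    - sign k * (+ suc k * + (k !)) * S m (suc k) + sign k * + (k !) * (+ suc k * S m (suc k))
      ≡⟨ cancel (sign k) (+ suc k) (+ (k !)) (S m (suc k)) ⟩
    + 0 ∎
    where
    cancel : ∀ s a f x → - s * (a * f) * x + s * f * (a * x) ≡ + 0
    cancel = solve-∀

  mul1+E-recipCoeff : ∀ m → mul1+E recipCoeff m ≡ δ m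
  mul1+E-recipCoeff m = begin
    mul1+E recipCoeff m
      ≡⟨ mul1+E-head recipCoeff m ⟩
    recipCoeff m + Σ r (λ j → + (m C suc j) * recipCoeff (m ∸ suc j))
      ≡⟨ cong₂ _+_ (sym (Σ-recipTerm-truncate {m} (suc (suc m)) (m<n⇒m<1+n (n<1+n m)))) (Σ-C[n,1+j]*recipCoeff m) ⟩
    Σ (suc (suc m)) (recipTerm m) + Σ (suc m) (λ k → sign k * + (k !) * (+ suc k * S m (suc k)))
      ≡⟨ cong (_+ Σ (suc m) (λ k → sign k * + (k !) * (+ suc k * S m (suc k)))) (Σ-head (suc m) (recipTerm m)) ⟩
    recipTerm m 0 + Σ (suc m) (λ k → recipTerm m (suc k)) + Σ (suc m) (λ k → sign k * + (k !) * (+ suc k * S m (suc k)))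
      ≡⟨ +-assoc (recipTerm m 0) _ _ ⟩
    recipTerm m 0 + (Σ (suc m) (λ k → recipTerm m (suc k)) + Σ (suc m) (λ k → sign k * + (k !) * (+ suc k * S m (suc k))))
      ≡⟨ cong (_+_ (recipTerm m 0)) (Σ-distrib-+ (suc m) (λ k → recipTerm m (suc k)) (λ k → sign k * + (k !) * (+ suc k * S m (suc k)))) ⟨
    recipTerm m 0 + Σ (suc m) (λ k → recipTerm m (suc k) + sign k * + (k !) * (+ suc k * S m (suc k)))
      ≡⟨ cong (_+_ (recipTerm m 0)) (Σ-zero (suc m) (λ k _ → recipTerm-suc-cancel m k)) ⟩
    recipTerm m 0 + + 0
      ≡⟨ +-identityʳ (recipTerm m 0) ⟩
    + 1 * + 1 * S m 0
      ≡⟨ *-identityˡ (S m 0) ⟩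
    S m 0
      ≡⟨ S-zero m ⟩
    δ m ∎

  mul1+E-logCoeff : ∀ n → mul1+E (λ m → logCoeff (suc m)) n ≡ 𝟙[ n < r ]
  mul1+E-logCoeff n = begin
    Σ (suc r) (λ j → + (n C j) * logCoeff (suc (n ∸ j)))
      ≡⟨ Σ-cong (suc r) (λ j _ → cong (+ (n C j) *_) (logCoeff-suc (n ∸ j))) ⟩
    Σ (suc r) (λ j → + (n C j) * Σ r (λ l → + ((n ∸ j) C l) * recipCoeff (n ∸ j ∸ l)))
      ≡⟨ Σ-C*Σ-C-comm n (suc r) r (λ j → j) (λ l → l) recipCoeff ⟩
    Σ r (λ l → + (n C l) * mul1+E recipCoeff (n ∸ l))
      ≡⟨ Σ-cong r (λ l _ → cong (+ (n C l) *_) (mul1+E-recipCoeff (n ∸ l))) ⟩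
    Σ r (λ l → + (n C l) * δ (n ∸ l))
      ≡⟨ Σ-C*δ r n ⟩
    𝟙[ n < r ] ∎

  mul1+E-cancel : ∀ N (a b : ℕ → ℤ) → (∀ n → n < N → mul1+E a n ≡ mul1+E b n) → ∀ n → n < N → a n ≡ b n
  mul1+E-cancel (suc N) a b a≐b n (s≤s n≤N) with m≤n⇒m<n∨m≡n n≤N
  ... | inj₁ n<N  = mul1+E-cancel N a b (λ m m<N → a≐b m (m<n⇒m<1+n m<N)) n n<N
  ... | inj₂ refl = ∙-cancelʳ (tail b) (a n) (b n) (begin
    a n + tail b   ≡⟨ cong (_+_ (a n)) (Σ-cong r (λ j _ → tails-agree j)) ⟨
    a n + tail a   ≡⟨ mul1+E-head a n ⟨
    mul1+E a n     ≡⟨ a≐b n ≤-refl ⟩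
    mul1+E b n     ≡⟨ mul1+E-head b n ⟩
    b n + tail b   ∎)
    where
    tail : (ℕ → ℤ) → ℤ
    tail x = Σ r (λ j → + (n C suc j) * x (n ∸ suc j))
    tails-agree : ∀ j → + (n C suc j) * a (n ∸ suc j) ≡ + (n C suc j) * b (n ∸ suc j)
    tails-agree j with ≤-<-connex (suc j) n
    ... | inj₁ j<n  = cong (+ (n C suc j) *_)
                        (mul1+E-cancel N a b (λ m m<N → a≐b m (m<n⇒m<1+n m<N)) (n ∸ suc j) (∸-monoʳ-< (s≤s z≤n) j<n))
    ... | inj₂ n≤j  rewrite k>n⇒nCk≡0 n≤j = refl

  logCoeffClosedForm : ℕ → ℤ
  logCoeffClosedForm n = δ n + sign (suc (n ℕ.+ r)) * + (n C r)

  private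
    sign-∸ : ∀ n j → j ≤ n → sign (suc (n ∸ j ℕ.+ r)) ≡ sign (suc (n ℕ.+ r)) * sign j
    sign-∸ n j j≤n = begin
      sign (suc (n ∸ j ℕ.+ r))                 ≡⟨ sign[a+b]*sign[b]≡sign[a] (suc (n ∸ j ℕ.+ r)) j ⟨
      sign (suc (n ∸ j ℕ.+ r ℕ.+ j)) * sign j  ≡⟨ cong (λ m → sign (suc m) * sign j) n∸j+r+j≡n+r ⟩
      sign (suc (n ℕ.+ r)) * sign j            ∎
      where
      n∸j+r+j≡n+r : n ∸ j ℕ.+ r ℕ.+ j ≡ n ℕ.+ r
      n∸j+r+j≡n+r = trans (ℕ.+-assoc (n ∸ j) r j) (trans (cong (n ∸ j ℕ.+_) (ℕ.+-comm r j))
                      (trans (sym (ℕ.+-assoc (n ∸ j) j r)) (cong (ℕ._+ r) (m∸n+n≡m j≤n))))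

    C[n,j]*signed-C[n∸j,r] : ∀ n j → + (n C j) * (sign (suc (n ∸ j ℕ.+ r)) * + ((n ∸ j) C r)) ≡
      sign (suc (n ℕ.+ r)) * + (n C r) * (sign j * + ((n ∸ r) C j))
    C[n,j]*signed-C[n∸j,r] n j with ≤-<-connex j n
    ... | inj₂ n<j rewrite k>n⇒nCk≡0 n<j | k>n⇒nCk≡0 (≤-<-trans (m∸n≤m n r) n<j) =
      sym (trans (cong (sign (suc (n ℕ.+ r)) * + (n C r) *_) (*-zeroʳ (sign j))) (*-zeroʳ (sign (suc (n ℕ.+ r)) * + (n C r))))
    ... | inj₁ j≤n = begin
      + (n C j) * (sign (suc (n ∸ j ℕ.+ r)) * + ((n ∸ j) C r))
        ≡⟨ cong (λ s → + (n C j) * (s * + ((n ∸ j) C r))) (sign-∸ n j j≤n) ⟩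
      + (n C j) * (σ * sign j * + ((n ∸ j) C r))
        ≡⟨ rearrange σ (sign j) (+ (n C j)) (+ ((n ∸ j) C r)) ⟩
      σ * sign j * (+ (n C j) * + ((n ∸ j) C r))
        ≡⟨ cong (σ * sign j *_) (trans (sym (pos-* (n C j) _)) (trans (cong +_ (nCa*[n∸a]Cb≡nCb*[n∸b]Ca n j r)) (pos-* (n C r) _))) ⟩
      σ * sign j * (+ (n C r) * + ((n ∸ r) C j))
        ≡⟨ rearrange′ σ (sign j) (+ (n C r)) (+ ((n ∸ r) C j)) ⟩
      σ * + (n C r) * (sign j * + ((n ∸ r) C j)) ∎
      where
      σ = sign (suc (n ℕ.+ r))
      rearrange : ∀ s t c d → c * (s * t * d) ≡ s * t * (c * d)
      rearrange = solve-∀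
      rearrange′ : ∀ s t c d → s * t * (c * d) ≡ s * c * (t * d)
      rearrange′ = solve-∀

    𝟙[<1+r]+correction : ∀ n → 𝟙[ n < suc r ] + sign (suc (n ℕ.+ r)) * + (n C r) * δ (n ∸ r) ≡ 𝟙[ n < r ]
    𝟙[<1+r]+correction n with <-cmp n r
    ... | tri< n<r _ _ = begin
      𝟙[ n < suc r ] + σ * + (n C r) * δ (n ∸ r)
        ≡⟨ cong₂ (λ i c → i + σ * + c * δ (n ∸ r)) (𝟙[<]-yes (m<n⇒m<1+n n<r)) (k>n⇒nCk≡0 n<r) ⟩
      + 1 + σ * + 0 * δ (n ∸ r)
        ≡⟨ cong (λ x → + 1 + x * δ (n ∸ r)) (*-zeroʳ σ) ⟩
      + 1
        ≡⟨ 𝟙[<]-yes n<r ⟨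
      𝟙[ n < r ] ∎
      where σ = sign (suc (n ℕ.+ r))
    ... | tri≈ _ refl _ = begin
      𝟙[ n < suc n ] + σ * + (n C n) * δ (n ∸ n)
        ≡⟨ cong₂ (λ c d → 𝟙[ n < suc n ] + σ * + c * δ d) (nCn≡1 n) (n∸n≡0 n) ⟩
      𝟙[ n < suc n ] + σ * + 1 * + 1
        ≡⟨ cong₂ (λ i s → i + s * + 1 * + 1) (𝟙[<]-yes (n<1+n n)) (trans (sign-suc (n ℕ.+ n)) (cong -_ (sign[n+n]≡1 n))) ⟩
      + 0
        ≡⟨ 𝟙[<]-no (≤-refl {n}) ⟨
      𝟙[ n < n ] ∎
      where σ = sign (suc (n ℕ.+ n))
    ... | tri> _ _ r<n = begin
      𝟙[ n < suc r ] + σ * + (n C r) * δ (n ∸ r)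
        ≡⟨ cong₂ (λ i d → i + σ * + (n C r) * d) (𝟙[<]-no r<n) (cong δ (+-∸-assoc 1 r<n)) ⟩
      + 0 + σ * + (n C r) * + 0
        ≡⟨ trans (+-identityˡ _) (*-zeroʳ (σ * + (n C r))) ⟩
      + 0
        ≡⟨ 𝟙[<]-no (<⇒≤ r<n) ⟨
      𝟙[ n < r ] ∎
      where σ = sign (suc (n ℕ.+ r))

  mul1+E-logCoeffClosedForm : ∀ n → n ≤ r ℕ.+ r → mul1+E logCoeffClosedForm n ≡ 𝟙[ n < r ]
  mul1+E-logCoeffClosedForm n n≤2r = begin
    Σ (suc r) (λ j → + (n C j) * (δ (n ∸ j) + part j))
      ≡⟨ Σ-cong (suc r) (λ j _ → *-distribˡ-+ (+ (n C j)) (δ (n ∸ j)) (part j)) ⟩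
    Σ (suc r) (λ j → + (n C j) * δ (n ∸ j) + + (n C j) * part j)
      ≡⟨ Σ-distrib-+ (suc r) _ _ ⟩
    Σ (suc r) (λ j → + (n C j) * δ (n ∸ j)) + Σ (suc r) (λ j → + (n C j) * part j)
      ≡⟨ cong₂ _+_ (Σ-C*δ (suc r) n) (Σ-cong (suc r) (λ j _ → C[n,j]*signed-C[n∸j,r] n j)) ⟩
    𝟙[ n < suc r ] + Σ (suc r) (λ j → σ * + (n C r) * (sign j * + ((n ∸ r) C j)))
      ≡⟨ cong (_+_ 𝟙[ n < suc r ]) (*-distribˡ-Σ (suc r) (σ * + (n C r)) _) ⟨
    𝟙[ n < suc r ] + σ * + (n C r) * Σ (suc r) (λ j → sign j * + ((n ∸ r) C j))
      ≡⟨ cong (λ x → 𝟙[ n < suc r ] + σ * + (n C r) * x) (Σ-sign*C≡δ (n ∸ r) r (m≤n+o⇒m∸n≤o n r n≤2r)) ⟩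
    𝟙[ n < suc r ] + σ * + (n C r) * δ (n ∸ r)
      ≡⟨ 𝟙[<1+r]+correction n ⟩
    𝟙[ n < r ] ∎
    where
    σ = sign (suc (n ℕ.+ r))
    part : ℕ → ℤ
    part j = sign (suc (n ∸ j ℕ.+ r)) * + ((n ∸ j) C r)

  logCoeff-closed : ∀ n → n ≤ r ℕ.+ r → logCoeff (suc n) ≡ logCoeffClosedForm n
  logCoeff-closed n n≤2r = mul1+E-cancel (suc (r ℕ.+ r)) (λ m → logCoeff (suc m)) logCoeffClosedForm
    (λ m m<1+2r → trans (mul1+E-logCoeff m) (sym (mul1+E-logCoeffClosedForm m (ℕ.s≤s⁻¹ m<1+2r)))) n (s≤s n≤2r)

  [1+c]*logCoeff[1+c+1+r] : ∀ c → c < r →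
    + suc c * logCoeff (suc c ℕ.+ suc r) ≡ sign (suc c ℕ.+ 1) * (+ suc r * + ((suc r ℕ.+ c) C suc r))
  [1+c]*logCoeff[1+c+1+r] c c<r = begin
    + suc c * logCoeff (suc (c ℕ.+ suc r))
      ≡⟨ cong (+ suc c *_) (logCoeff-closed (c ℕ.+ suc r) (subst (ℕ._≤ r ℕ.+ r) (sym (ℕ.+-suc c r)) (ℕ.+-monoˡ-≤ r c<r))) ⟩
    + suc c * (δ (c ℕ.+ suc r) + sign (suc (c ℕ.+ suc r ℕ.+ r)) * + ((c ℕ.+ suc r) C r))
      ≡⟨ cong₂ (λ m e → + suc c * (δ m + sign e * + ((c ℕ.+ suc r) C r))) (ℕ.+-suc c r) (exponent c r) ⟩
    + suc c * (+ 0 + sign (suc c ℕ.+ 1 ℕ.+ (r ℕ.+ r)) * + ((c ℕ.+ suc r) C r))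
      ≡⟨ cong (λ s → + suc c * (+ 0 + s * + ((c ℕ.+ suc r) C r))) (sign[a+[n+n]]≡sign[a] (suc c ℕ.+ 1) r) ⟩
    + suc c * (+ 0 + σ * + ((c ℕ.+ suc r) C r))
      ≡⟨ x*[0+s*y]≡s*[x*y] (+ suc c) σ _ ⟩
    σ * (+ suc c * + ((c ℕ.+ suc r) C r))
      ≡⟨ cong (σ *_) (trans (sym (pos-* (suc c) _)) (trans (cong +_ absorption) (pos-* (suc r) _))) ⟩
    σ * (+ suc r * + ((suc r ℕ.+ c) C suc r)) ∎
    where
    open import Data.Nat.Tactic.RingSolver as ℕ-Solver using ()
    σ = sign (suc c ℕ.+ 1)
    exponent : ∀ c r → suc (c ℕ.+ suc r ℕ.+ r) ≡ suc c ℕ.+ 1 ℕ.+ (r ℕ.+ r)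
    exponent = ℕ-Solver.solve-∀
    x*[0+s*y]≡s*[x*y] : ∀ x s y → x * (+ 0 + s * y) ≡ s * (x * y)
    x*[0+s*y]≡s*[x*y] = solve-∀
    absorption : suc c ℕ.* ((c ℕ.+ suc r) C r) ≡ suc r ℕ.* ((suc r ℕ.+ c) C suc r)
    absorption = begin
      suc c ℕ.* ((c ℕ.+ suc r) C r) ≡⟨ cong (λ m → suc c ℕ.* (m C r)) (ℕ.+-comm c (suc r)) ⟩
      suc c ℕ.* ((suc r ℕ.+ c) C r) ≡⟨ cong (λ m → suc c ℕ.* (m C r)) (ℕ.+-suc r c) ⟨
      suc c ℕ.* ((r ℕ.+ suc c) C r) ≡⟨ d*[k+d]Ck≡[1+k]*[k+d]C[1+k] r (suc c) ⟩
      suc r ℕ.* ((r ℕ.+ suc c) C suc r) ≡⟨ cong (λ m → suc r ℕ.* (m C suc r)) (ℕ.+-suc r c) ⟩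
      suc r ℕ.* ((suc r ℕ.+ c) C suc r) ∎

open import Data.Nat using (_+_; _*_; _^_)
open import Data.Nat.Properties using (+-identityʳ; *-identityʳ; +-suc; <⇒≤)
open import Data.Nat.Primality using (Prime)
open import Data.Nat.Combinatorics using (nCn≡1)
open import Data.Integer as ℤ using (+_)
open import Data.Integer.Properties using (pos-+; pos-*)
open import Data.Integer.Divisibility using (_∣_)
open import Data.Integer.Divisibility.Signed as Signed using (∣⇒∣ᵤ; ∣ᵤ⇒∣; ∣m∣n⇒∣m+n; ∣n⇒∣m*n; *-monoʳ-∣)
open import Data.Integer.Tactic.RingSolver using (solve-∀)
open Binomial using (pascal; [1+r]∣[1+r+c]Cr)
open FiniteSums using (sumℤ1≡Σ)
open RestrictedStirling using (logCoeff; [1+c]*logCoeff[1+c+1+r])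

[1+r+c]C[1+r]≡1-mod-[1+r] : ∀ r c → Prime (suc r) → c ≤ r → + suc r Signed.∣ (+ ((suc r + c) C suc r) ℤ.- + 1)
[1+r+c]C[1+r]≡1-mod-[1+r] r zero    _       _   rewrite +-identityʳ r | nCn≡1 (suc r) = Signed.divides (+ 0) refl
[1+r+c]C[1+r]≡1-mod-[1+r] r (suc c) p-prime c<r = subst (+ suc r Signed.∣_) pascal-step
  (∣m∣n⇒∣m+n {m = + ((suc r + c) C r)} (∣ᵤ⇒∣ ([1+r]∣[1+r+c]Cr r c p-prime c<r)) ([1+r+c]C[1+r]≡1-mod-[1+r] r c p-prime (<⇒≤ c<r)))
  where
  open ≡-Reasoning
  pascal-step : + ((suc r + c) C r) ℤ.+ (+ ((suc r + c) C suc r) ℤ.- + 1) ≡ + ((suc r + suc c) C suc r) ℤ.- + 1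
  pascal-step = begin
    + ((suc r + c) C r) ℤ.+ (+ ((suc r + c) C suc r) ℤ.- + 1)   ≡⟨ ℤ-assoc (+ ((suc r + c) C r)) (+ ((suc r + c) C suc r)) (+ 1) ⟩
    + ((suc r + c) C r) ℤ.+ + ((suc r + c) C suc r) ℤ.- + 1     ≡⟨ cong (ℤ._- + 1) (pos-+ ((suc r + c) C r) ((suc r + c) C suc r)) ⟨
    + ((suc r + c) C r + (suc r + c) C suc r) ℤ.- + 1          ≡⟨ cong (λ m → + m ℤ.- + 1) (pascal (suc r + c) r) ⟨
    + (suc (suc r + c) C suc r) ℤ.- + 1                         ≡⟨ cong (λ m → + (m C suc r) ℤ.- + 1) (+-suc (suc r) c) ⟨
    + ((suc r + suc c) C suc r) ℤ.- + 1                         ∎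
    where
    ℤ-assoc : ∀ a b c → a ℤ.+ (b ℤ.- c) ≡ a ℤ.+ b ℤ.- c
    ℤ-assoc = solve-∀

proposition2p6 : (p i : ℕ) → Prime p → 3 ≤ p → 1 ≤ i → i ≤ p ∸ 1 →
    (+ (p ^ 2)) ∣ ((+ i) ℤ.* sumℤ1 (i + p) (λ m → sign (m ∸ 1) ℤ.* (+ ((m ∸ 1) !)) ℤ.* (+ stirling≤ (p ∸ 1) (i + p) m))
    ℤ.- sign (i + 1) ℤ.* (+ p))
proposition2p6 (suc r) (suc c) p-prime _ _ c<r =
  ∣⇒∣ᵤ (subst₂ Signed._∣_ p*p≡p^2 (sym reduced)
    (∣n⇒∣m*n σ (*-monoʳ-∣ (+ suc r) ([1+r+c]C[1+r]≡1-mod-[1+r] r c p-prime (<⇒≤ c<r)))))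
  where
  open ≡-Reasoning
  σ = sign (suc c + 1)
  M = (suc r + c) C suc r
  reduced : + suc c ℤ.* sumℤ1 (suc c + suc r) (λ m → sign (m ∸ 1) ℤ.* (+ ((m ∸ 1) !)) ℤ.* (+ stirling≤ r (suc c + suc r) m))
              ℤ.- σ ℤ.* + suc r ≡ σ ℤ.* (+ suc r ℤ.* (+ M ℤ.- + 1))
  reduced = begin
    + suc c ℤ.* sumℤ1 (suc c + suc r) _ ℤ.- σ ℤ.* + suc r
      ≡⟨ cong (λ x → + suc c ℤ.* x ℤ.- σ ℤ.* + suc r) (sumℤ1≡Σ (suc c + suc r) _) ⟩
    + suc c ℤ.* logCoeff r (suc c + suc r) ℤ.- σ ℤ.* + suc r
      ≡⟨ cong (ℤ._- σ ℤ.* + suc r) ([1+c]*logCoeff[1+c+1+r] r c c<r) ⟩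
    σ ℤ.* (+ suc r ℤ.* + M) ℤ.- σ ℤ.* + suc r
      ≡⟨ factor σ (+ suc r) (+ M) ⟩
    σ ℤ.* (+ suc r ℤ.* (+ M ℤ.- + 1)) ∎
    where
    factor : ∀ s p m → s ℤ.* (p ℤ.* m) ℤ.- s ℤ.* p ≡ s ℤ.* (p ℤ.* (m ℤ.- + 1))
    factor = solve-∀
  p*p≡p^2 : + suc r ℤ.* + suc r ≡ + (suc r ^ 2)
  p*p≡p^2 = trans (sym (pos-* (suc r) (suc r))) (cong (λ m → + (suc r * m)) (sym (*-identityʳ (suc r))))
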